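{- Let $R$ be a commutative ring, $E$ a real quadratic field and $G$ a subgroup of $\mathrm{GL}_2(\mathbb{Q})$. Then: (i) the image of $\psi_{G,E}$ lies in $H_0^{\mathrm{cusp}}(G,\mathrm{St}(\mathbb{Q}^2;R))$; (ii) for any $x,y\in\mathbb{P}^1(\mathbb{Q})$ and $\gamma\in G$, $[x,\gamma x]_G=[y,\gamma y]_G$ (so the description of the image of $\psi_{G,E}$ via symbols $[e,\gamma e]_G$ does not depend on the base point $e$).
   Context: Steinberg module: $\mathrm{St}(K^2;R)=\tilde H_0(\mathbb{P}^1(K);R)$ for a field $K$, generated by modular symbols $[v,w]$ ($v,w\in\mathbb{P}^1(K)$, boundary $w-v$) with $g[v,w]=[gv,gw]$, $[v,w]=-[w,v]$, $[v,w]=[v,x]+[x,w]$; $[v,w]_G$ is its image in $H_0(G,\mathrm{St}(K^2;R))$. $\psi_{G,E}:H_1(G,C)\to H_0(G,\mathrm{St}(\mathbb{Q}^2;R))$ is minus the connecting homomorphism of the long exact sequence in $G$-homology for $0\to\mathrm{St}(\mathbb{Q}^2;R)\to\mathrm{St}(E^2;R)\to C\to0$, the first map induced by $\mathbb{P}^1(\mathbb{Q})\subset\mathbb{P}^1(E)$. With $\mathcal D(R)$ the $R$-divisors on $\mathbb{P}^1(\mathbb{Q})$ and $\partial[u,v]=(v)-(u)$, $H_0^{\mathrm{cusp}}(G,\mathrm{St}(\mathbb{Q}^2;R))$ is the kernel of the induced map $H_0(G,\mathrm{St}(\mathbb{Q}^2;R))\to H_0(G,\mathcal D(R))$. -}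

module Defs where

open import Level using (Level; _⊔_)
open import Algebra.Bundles using (CommutativeRing)
open import Data.Nat as ℕ using (ℕ)
import Data.Integer
open import Data.Rational as ℚ using (ℚ; 0ℚ; 1ℚ; _÷_; ≢-nonZero)
open import Data.Rational.Properties as ℚP using ()
open import Data.Product using (Σ; _×_; _,_; proj₁; proj₂)
open import Data.Product.Properties as ×P using ()
open import Data.Sum using (_⊎_; inj₁; inj₂)
open import Data.Sum.Properties as ⊎P using ()
open import Data.Unit using (⊤; tt)
open import Data.List using (List; []; _∷_; _++_; map; foldr)
open import Data.List.Relation.Unary.All using (All)
open import Relation.Nullary using (yes; no; ¬_)
open import Relation.Binary.Definitions using (DecidableEquality)
open import Relation.Binary.PropositionalEquality using (_≡_; _≢_)

record Mat : Set where
  constructor mat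
  field a b c d : ℚ

open Mat public

_·ₘ_ : Mat → Mat → Mat
mat a₁ b₁ c₁ d₁ ·ₘ mat a₂ b₂ c₂ d₂ =
  mat (a₁ ℚ.* a₂ ℚ.+ b₁ ℚ.* c₂) (a₁ ℚ.* b₂ ℚ.+ b₁ ℚ.* d₂)
      (c₁ ℚ.* a₂ ℚ.+ d₁ ℚ.* c₂) (c₁ ℚ.* b₂ ℚ.+ d₁ ℚ.* d₂)

Iₘ : Mat
Iₘ = mat 1ℚ 0ℚ 0ℚ 1ℚ

record IsSubgroupGL₂ℚ (G : Mat → Set) : Set where
  field
    id∈   : G Iₘ
    mul∈  : ∀ {g h} → G g → G h → G (g ·ₘ h)
    inv∈  : ∀ {g} → G g → Σ Mat λ h → G h × (g ·ₘ h ≡ Iₘ) × (h ·ₘ g ≡ Iₘ)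

record FieldOps : Set₁ where
  field
    K     : Set
    _≟_   : DecidableEquality K
    _+_   : K → K → K
    _*_   : K → K → K
    zero  : K
    inv   : K → K        -- multiplicative inverse (inv zero = zero, never used)
    emb   : ℚ → K
  infixl 6 _+_
  infixl 7 _*_

ℙ¹ : FieldOps → Set
ℙ¹ F = FieldOps.K F ⊎ ⊤          -- inj₂ tt is the point ∞ = [1:0]

ℙ¹-≟ : (F : FieldOps) → DecidableEquality (ℙ¹ F)
ℙ¹-≟ F = ⊎P.≡-dec (FieldOps._≟_ F) λ { tt tt → yes Relation.Binary.PropositionalEquality.refl }

-- g · [x:1] = [ax+b : cx+d],  g · [1:0] = [a : c]
act : (F : FieldOps) → Mat → ℙ¹ F → ℙ¹ F
act F (mat a b c d) (inj₁ x) with (emb c * x + emb d) ≟ zero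
  where open FieldOps F
... | yes _ = inj₂ tt
... | no  _ = inj₁ ((emb a * x + emb b) * inv (emb c * x + emb d))
  where open FieldOps F
act F (mat a b c d) (inj₂ tt) with emb c ≟ zero
  where open FieldOps F
... | yes _ = inj₂ tt
... | no  _ = inj₁ (emb a * inv (emb c))
  where open FieldOps F

invℚ : ℚ → ℚ
invℚ p with p ℚP.≟ 0ℚ
... | yes _  = 0ℚ
... | no p≢0 = ℚ.1/_ p {{≢-nonZero p≢0}}

ℚF : FieldOps
ℚF = record { K = ℚ ; _≟_ = ℚP._≟_ ; _+_ = ℚ._+_ ; _*_ = ℚ._*_ ; zero = 0ℚ
            ; inv = invℚ ; emb = λ q → q }

-- The real quadratic field E = ℚ(√D) (D > 1 not a square), elements
-- (x , y) standing for x + y√D.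
NonSquare : ℕ → Set
NonSquare D = ∀ n → ¬ (n ℕ.* n ≡ D)

QuadF : ℕ → FieldOps
QuadF D = record
  { K = ℚ × ℚ
  ; _≟_ = ×P.≡-dec ℚP._≟_ ℚP._≟_
  ; _+_ = λ { (x , y) (u , v) → (x ℚ.+ u , y ℚ.+ v) }
  ; _*_ = λ { (x , y) (u , v) → (x ℚ.* u ℚ.+ Dℚ ℚ.* y ℚ.* v , x ℚ.* v ℚ.+ y ℚ.* u) }
  ; zero = (0ℚ , 0ℚ)
  ; inv = λ { (x , y) → let N = x ℚ.* x ℚ.- Dℚ ℚ.* y ℚ.* y
                        in (x ℚ.* invℚ N , ℚ.- (y ℚ.* invℚ N)) }
  ; emb = λ q → (q , 0ℚ)
  }
  where Dℚ = ℚ._/_ (Data.Integer.+_ D) 1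

ιℙ¹ : (D : ℕ) → ℙ¹ ℚF → ℙ¹ (QuadF D)
ιℙ¹ D (inj₁ q)  = inj₁ (q , 0ℚ)
ιℙ¹ D (inj₂ tt) = inj₂ tt

module _ {c ℓ} (R : CommutativeRing c ℓ) where
  open CommutativeRing R renaming (Carrier to Rc)

  -- finite formal R-linear combinations of points of X (R-divisors on X)
  Div : Set → Set c
  Div X = List (Rc × X)

  coeff : {X : Set} → DecidableEquality X → Div X → X → Rc
  coeff _≟ₓ_ []            x = 0#
  coeff _≟ₓ_ ((r , p) ∷ s) x with p ≟ₓ x
  ... | yes _ = r + coeff _≟ₓ_ s x
  ... | no  _ = coeff _≟ₓ_ s x

  DivEq : {X : Set} → DecidableEquality X → Div X → Div X → Set ℓ
  DivEq eq s t = ∀ x → coeff eq s x ≈ coeff eq t x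

  deg : {X : Set} → Div X → Rc
  deg = foldr (λ rp acc → proj₁ rp + acc) 0#

  -- St(K²;R) = H̃₀(ℙ¹(K);R): degree-zero divisors
  InSt : {X : Set} → Div X → Set ℓ
  InSt s = deg s ≈ 0#

  negDiv : {X : Set} → Div X → Div X
  negDiv = map λ { (r , p) → (- r , p) }

  mapDiv : {X Y : Set} → (X → Y) → Div X → Div Y
  mapDiv f = map λ { (r , p) → (r , f p) }

  ms : {X : Set} → X → X → Div X
  ms v w = (1# , w) ∷ (- 1# , v) ∷ []

  Σact : {X : Set} → (Mat → X → X) → List (Mat × Div X) → Div X
  Σact α []            = []
  Σact α ((g , m) ∷ z) = mapDiv (α g) m ++ negDiv m ++ Σact α z

  -- equality in the coinvariants H₀(G,M), M ⊆ Div X the submodule given by P: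
  -- s - t lies in the R-span of {g m - m : g ∈ G, m ∈ M}
  CoinvEq : {X : Set} → DecidableEquality X → (Mat → X → X) → (G : Mat → Set)
            → (P : Div X → Set ℓ) → Div X → Div X → Set (c ⊔ ℓ)
  CoinvEq {X} eq α G P s t =
    Σ (List (Mat × Div X)) λ z →
      All (λ gm → G (proj₁ gm) × P (proj₂ gm)) z ×
      DivEq eq (s ++ negDiv t) (Σact α z)

  _≈St[_]_ : Div (ℙ¹ ℚF) → (Mat → Set) → Div (ℙ¹ ℚF) → Set (c ⊔ ℓ)
  s ≈St[ G ] t = CoinvEq (ℙ¹-≟ ℚF) (act ℚF) G InSt s t

  -- H₀^cusp(G, St(ℚ²;R)): classes of s ∈ St(ℚ²;R) whose image in H₀(G, 𝒟(R))
  -- vanishes (the map St → 𝒟 induced by ∂[u,v] = (v) - (u) is the inclusion)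
  InH₀cusp : (Mat → Set) → Div (ℙ¹ ℚF) → Set (c ⊔ ℓ)
  InH₀cusp G s = InSt s × CoinvEq (ℙ¹-≟ ℚF) (act ℚF) G (λ _ → Lift ℓ ⊤) s []
    where open Level using (Lift)

  -- A 1-chain Σ gⱼ ⊗ cⱼ in the bar complex for C = St(E²;R)/St(ℚ²;R) is given
  -- by lifts mⱼ ∈ St(E²;R) of cⱼ; it is a cycle iff Σ (gⱼ mⱼ - mⱼ) lies in
  -- St(ℚ²;R), and ψ (up to sign) sends it to the class of that element.
  InImψ : (D : ℕ) → (Mat → Set) → Div (ℙ¹ ℚF) → Set (c ⊔ ℓ)
  InImψ D G s =
    Σ (List (Mat × Div (ℙ¹ (QuadF D)))) λ z →
      All (λ gm → G (proj₁ gm) × InSt (proj₂ gm)) z ×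
      Σ (Div (ℙ¹ ℚF)) λ s' →
        DivEq (ℙ¹-≟ (QuadF D)) (mapDiv (ιℙ¹ D) s') (Σact (act (QuadF D)) z) ×
        (s ≈St[ G ] s')

{-# OPTIONS --safe #-}
-- A class in the image of ψ is represented by s′ ∈ St(ℚ²;R) whose image in St(E²;R) equals
-- Σⱼ (gⱼ mⱼ − mⱼ) with gⱼ ∈ G and mⱼ ∈ St(E²;R). Möbius transformations with rational entries map
-- ℙ¹(ℚ) ⊂ ℙ¹(E) to itself and, because √D ∉ ℚ, map irrational points to irrational points; so
-- restricting every mⱼ to its rational points gives divisors m′ⱼ on ℙ¹(ℚ) with s′ = Σⱼ (gⱼ m′ⱼ − m′ⱼ).
-- The m′ⱼ need not have degree zero, which is why the class of s′ only vanishes in H₀(G, 𝒟(R)).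
-- Part (ii) is the identity [x, γx] − [y, γy] = γ[y, x] − [y, x].
module Submission where

open import Defs hiding (a; b; c; d)
open import Level using (lift; _⊔_)
open import Algebra.Bundles using (CommutativeRing)
open import Data.Nat as ℕ using (ℕ; suc; _<_)
import Data.Nat.Properties as ℕP
open import Data.Nat.Coprimality as Coprimality using (Coprime)
open import Data.Nat.Divisibility using (divides; ∣-refl)
open import Data.Integer as ℤ using (+_)
import Data.Integer.Properties as ℤP
open import Data.Rational as ℚ using (ℚ; mkℚ; 0ℚ; 1ℚ)
import Data.Rational.Properties as ℚP
import Data.Rational.Unnormalised as ℚᵘ
import Data.Rational.Unnormalised.Properties as ℚᵘP
open import Data.Rational.Solver using (module +-*-Solver)
open +-*-Solver
open import Algebra.Apartness.Properties.HeytingCommutativeRing ℚP.heytingCommutativeRing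
  using (x#0y#0→xy#0)
open import Data.Product using (_×_; _,_; proj₁; proj₂; map₂)
open import Data.Sum using (inj₁; inj₂; map₁)
open import Data.Unit using (tt)
open import Data.Empty using (⊥-elim)
open import Data.Maybe using (Maybe; just; nothing)
open import Data.Maybe.Properties using (just-injective)
open import Function using (_∘_)
open import Data.List using (List; []; _∷_; _++_; map)
import Data.List.Properties as ListP
import Relation.Binary.Reasoning.Setoid
open import Data.List.Relation.Unary.All as All using (All; []; _∷_)
import Data.List.Relation.Unary.All.Properties as AllP
open import Relation.Nullary using (yes; no)
open import Relation.Binary.Definitions using (DecidableEquality)
open import Relation.Binary.PropositionalEquality as ≡
  using (_≡_; _≢_; refl; cong; cong₂; module ≡-Reasoning)

module Rationals where

  *-≢0 : ∀ {p q} → p ≢ 0ℚ → q ≢ 0ℚ → p ℚ.* q ≢ 0ℚ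
  *-≢0 = x#0y#0→xy#0

  invℚ-inverseʳ : ∀ {p} → p ≢ 0ℚ → p ℚ.* invℚ p ≡ 1ℚ
  invℚ-inverseʳ {p} p≢0 with p ℚP.≟ 0ℚ
  ... | yes p≡0 = ⊥-elim (p≢0 p≡0)
  ... | no  p≢0 = ℚP.*-inverseʳ p {{ℚ.≢-nonZero p≢0}}

  invℚ-≢0 : ∀ {p} → p ≢ 0ℚ → invℚ p ≢ 0ℚ
  invℚ-≢0 {p} p≢0 p⁻¹≡0 = ℚP.1≢0 (begin
    1ℚ              ≡⟨ ≡.sym (invℚ-inverseʳ p≢0) ⟩
    p ℚ.* invℚ p    ≡⟨ cong (p ℚ.*_) p⁻¹≡0 ⟩
    p ℚ.* 0ℚ        ≡⟨ ℚP.*-zeroʳ p ⟩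
    0ℚ              ∎)
    where open ≡-Reasoning

  invℚ-cancel : ∀ {p} → p ≢ 0ℚ → p ℚ.* invℚ (p ℚ.* p) ≡ invℚ p
  invℚ-cancel {p} p≢0 = begin
    p ℚ.* q                        ≡⟨ ℚP.*-identityˡ (p ℚ.* q) ⟨
    1ℚ ℚ.* (p ℚ.* q)               ≡⟨ cong (ℚ._* (p ℚ.* q)) p⁻¹p≡1 ⟨
    p⁻¹ ℚ.* p ℚ.* (p ℚ.* q)        ≡⟨ solve 3 (λ p⁻¹ p q → p⁻¹ :* p :* (p :* q) := p⁻¹ :* (p :* p :* q)) refl p⁻¹ p q ⟩
    p⁻¹ ℚ.* (p ℚ.* p ℚ.* q)        ≡⟨ cong (p⁻¹ ℚ.*_) (invℚ-inverseʳ (*-≢0 p≢0 p≢0)) ⟩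
    p⁻¹ ℚ.* 1ℚ                     ≡⟨ ℚP.*-identityʳ p⁻¹ ⟩
    p⁻¹                            ∎
    where
    open ≡-Reasoning
    p⁻¹ = invℚ p
    q = invℚ (p ℚ.* p)
    p⁻¹p≡1 : p⁻¹ ℚ.* p ≡ 1ℚ
    p⁻¹p≡1 = ≡.trans (ℚP.*-comm p⁻¹ p) (invℚ-inverseʳ p≢0)

module QuadraticIrrationality where
  open Rationals

  coprime-square⇒denominator≡1 : ∀ {m d D} → Coprime m d → m ℕ.* m ≡ D ℕ.* (d ℕ.* d) → d ≡ 1
  coprime-square⇒denominator≡1 {m} {d} {D} m⊥d eq = m⊥d (d∣m , ∣-refl)
    where
    d∣m = Coprimality.coprime-divisor (Coprimality.sym m⊥d)
            (divides (D ℕ.* d) (≡.trans eq (≡.sym (ℕP.*-assoc D d d))))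

  -- Literally the constant of the multiplication of QuadF D, so that ring identities in QuadF D
  -- can be checked by the solver.
  Dℚ : ℕ → ℚ
  Dℚ D = + D ℚ./ 1

  nonSquare⇒irrational : ∀ {D} → NonSquare D → ∀ r → r ℚ.* r ≢ Dℚ D
  nonSquare⇒irrational {D} ns r@(mkℚ n d-1 n⊥d)  r²≡D
    with ℚᵘP.≃-trans (ℚᵘP.≃-sym (ℚP.toℚᵘ-homo-* r r))
                     (ℚP.toℚᵘ-cong (≡.trans r²≡D (ℚP.normalize-coprime (Coprimality.sym (Coprimality.1-coprimeTo D)))))
  ... | ℚᵘ.*≡* n²≡Dd² = ns ∣n∣ (begin
      ∣n∣ ℕ.* ∣n∣           ≡⟨ m²≡Dd² ⟩
      D ℕ.* (d ℕ.* d)       ≡⟨ cong (λ k → D ℕ.* (k ℕ.* k)) d≡1 ⟩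
      D ℕ.* 1               ≡⟨ ℕP.*-identityʳ D ⟩
      D                     ∎)
    where
    open ≡-Reasoning
    ∣n∣ = ℤ.∣ n ∣
    d = suc d-1
    m²≡Dd² : ∣n∣ ℕ.* ∣n∣ ≡ D ℕ.* (d ℕ.* d)
    m²≡Dd² = begin
      ∣n∣ ℕ.* ∣n∣                   ≡⟨ ≡.sym (ℕP.*-identityʳ _) ⟩
      ∣n∣ ℕ.* ∣n∣ ℕ.* 1             ≡⟨ cong (ℕ._* 1) (≡.sym (ℤP.abs-* n n)) ⟩
      ℤ.∣ n ℤ.* n ∣ ℕ.* 1           ≡⟨ ≡.sym (ℤP.abs-* (n ℤ.* n) (+ 1)) ⟩
      ℤ.∣ n ℤ.* n ℤ.* + 1 ∣         ≡⟨ cong ℤ.∣_∣ n²≡Dd² ⟩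
      ℤ.∣ + D ℤ.* + (d ℕ.* d) ∣     ≡⟨ ℤP.abs-* (+ D) (+ (d ℕ.* d)) ⟩
      D ℕ.* (d ℕ.* d)               ∎
    d≡1 : d ≡ 1
    d≡1 = coprime-square⇒denominator≡1 {D = D} (Coprimality.recompute n⊥d) m²≡Dd²

  norm≢0 : ∀ {D} → NonSquare D → ∀ {x y} → (x , y) ≢ (0ℚ , 0ℚ) →
           x ℚ.* x ℚ.- Dℚ D ℚ.* y ℚ.* y ≢ 0ℚ
  norm≢0 {D} ns {x} {y} xy≢0 N≡0 with y ℚP.≟ 0ℚ
  ... | yes refl = *-≢0 x≢0 x≢0 (≡.trans (solve 2 (λ x D → x :* x := x :* x :- D :* con 0ℚ :* con 0ℚ) refl x (Dℚ D)) N≡0)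
    where
    x≢0 : x ≢ 0ℚ
    x≢0 x≡0 = xy≢0 (cong (_, 0ℚ) x≡0)
  ... | no y≢0 = nonSquare⇒irrational ns (x ℚ.* y⁻¹) (begin
      x ℚ.* y⁻¹ ℚ.* (x ℚ.* y⁻¹)
        ≡⟨ solve 4 (λ x y y⁻¹ D → x :* y⁻¹ :* (x :* y⁻¹) := (x :* x :- D :* y :* y) :* y⁻¹ :* y⁻¹ :+ D :* (y :* y⁻¹) :* (y :* y⁻¹))
                 refl x y y⁻¹ (Dℚ D) ⟩
      (x ℚ.* x ℚ.- Dℚ D ℚ.* y ℚ.* y) ℚ.* y⁻¹ ℚ.* y⁻¹ ℚ.+ Dℚ D ℚ.* (y ℚ.* y⁻¹) ℚ.* (y ℚ.* y⁻¹)
        ≡⟨ cong₂ (λ N u → N ℚ.* y⁻¹ ℚ.* y⁻¹ ℚ.+ Dℚ D ℚ.* u ℚ.* u) N≡0 (invℚ-inverseʳ y≢0) ⟩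
      0ℚ ℚ.* y⁻¹ ℚ.* y⁻¹ ℚ.+ Dℚ D ℚ.* 1ℚ ℚ.* 1ℚ
        ≡⟨ solve 2 (λ y⁻¹ D → con 0ℚ :* y⁻¹ :* y⁻¹ :+ D :* con 1ℚ :* con 1ℚ := D) refl y⁻¹ (Dℚ D) ⟩
      Dℚ D ∎)
    where
    open ≡-Reasoning
    y⁻¹ = invℚ y

module Homogeneous (F : FieldOps) where
  open FieldOps F

  [_∶_] : K → K → ℙ¹ F
  [ n ∶ w ] with w ≟ zero
  ... | yes _ = inj₂ tt
  ... | no  _ = inj₁ (n * inv w)

  act-finite : ∀ a b c d x → act F (mat a b c d) (inj₁ x) ≡ [ emb a * x + emb b ∶ emb c * x + emb d ]
  act-finite a b c d x with (emb c * x + emb d) ≟ zero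
  ... | yes _ = refl
  ... | no  _ = refl

  act-∞ : ∀ a b c d → act F (mat a b c d) (inj₂ tt) ≡ [ emb a ∶ emb c ]
  act-∞ a b c d with emb c ≟ zero
  ... | yes _ = refl
  ... | no  _ = refl

record IsFieldEmbedding (F F′ : FieldOps) (h : FieldOps.K F → FieldOps.K F′) : Set where
  private
    module F  = FieldOps F
    module F′ = FieldOps F′
  field
    injective : ∀ {x y} → h x ≡ h y → x ≡ y
    zero-homo : h F.zero ≡ F′.zero
    +-homo    : ∀ x y → h (x F.+ y) ≡ h x F′.+ h y
    *-homo    : ∀ x y → h (x F.* y) ≡ h x F′.* h y
    inv-homo  : ∀ {x} → x ≢ F.zero → h (F.inv x) ≡ F′.inv (h x)
    emb-homo  : ∀ q → h (F.emb q) ≡ F′.emb q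

module _ {F F′ : FieldOps} {h : FieldOps.K F → FieldOps.K F′} (embedding : IsFieldEmbedding F F′ h) where
  private
    module F  = FieldOps F
    module F′ = FieldOps F′
    module H  = Homogeneous F
    module H′ = Homogeneous F′
  open IsFieldEmbedding embedding

  map-[∶] : ∀ n w → map₁ h H.[ n ∶ w ] ≡ H′.[ h n ∶ h w ]
  map-[∶] n w with w F.≟ F.zero | h w F′.≟ F′.zero
  ... | yes _   | yes _    = refl
  ... | yes w≡0 | no hw≢0  = ⊥-elim (hw≢0 (≡.trans (cong h w≡0) zero-homo))
  ... | no w≢0  | yes hw≡0 = ⊥-elim (w≢0 (injective (≡.trans hw≡0 (≡.sym zero-homo))))
  ... | no w≢0  | no _     = cong inj₁ (≡.trans (*-homo n (F.inv w)) (cong (h n F′.*_) (inv-homo w≢0)))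

  affine-homo : ∀ a b x → h (F.emb a F.* x F.+ F.emb b) ≡ F′.emb a F′.* h x F′.+ F′.emb b
  affine-homo a b x = begin
    h (F.emb a F.* x F.+ F.emb b)          ≡⟨ +-homo _ _ ⟩
    h (F.emb a F.* x) F′.+ h (F.emb b)     ≡⟨ cong (F′._+ h (F.emb b)) (*-homo _ _) ⟩
    h (F.emb a) F′.* h x F′.+ h (F.emb b)  ≡⟨ cong₂ (λ a′ b′ → a′ F′.* h x F′.+ b′) (emb-homo a) (emb-homo b) ⟩
    F′.emb a F′.* h x F′.+ F′.emb b        ∎
    where open ≡-Reasoning

  act-map₁ : ∀ g p → act F′ g (map₁ h p) ≡ map₁ h (act F g p)
  act-map₁ (mat a b c d) (inj₁ x) = begin
    act F′ (mat a b c d) (inj₁ (h x))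
      ≡⟨ H′.act-finite a b c d (h x) ⟩
    H′.[ F′.emb a F′.* h x F′.+ F′.emb b ∶ F′.emb c F′.* h x F′.+ F′.emb d ]
      ≡⟨ ≡.sym (cong₂ H′.[_∶_] (affine-homo a b x) (affine-homo c d x)) ⟩
    H′.[ h (F.emb a F.* x F.+ F.emb b) ∶ h (F.emb c F.* x F.+ F.emb d) ]
      ≡⟨ ≡.sym (map-[∶] _ _) ⟩
    map₁ h H.[ F.emb a F.* x F.+ F.emb b ∶ F.emb c F.* x F.+ F.emb d ]
      ≡⟨ cong (map₁ h) (≡.sym (H.act-finite a b c d x)) ⟩
    map₁ h (act F (mat a b c d) (inj₁ x)) ∎
    where open ≡-Reasoning
  act-map₁ (mat a b c d) (inj₂ tt) = begin
    act F′ (mat a b c d) (inj₂ tt)          ≡⟨ H′.act-∞ a b c d ⟩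
    H′.[ F′.emb a ∶ F′.emb c ]              ≡⟨ ≡.sym (cong₂ H′.[_∶_] (emb-homo a) (emb-homo c)) ⟩
    H′.[ h (F.emb a) ∶ h (F.emb c) ]        ≡⟨ ≡.sym (map-[∶] _ _) ⟩
    map₁ h H.[ F.emb a ∶ F.emb c ]          ≡⟨ cong (map₁ h) (≡.sym (H.act-∞ a b c d)) ⟩
    map₁ h (act F (mat a b c d) (inj₂ tt))  ∎
    where open ≡-Reasoning

det : Mat → ℚ
det (mat a b c d) = a ℚ.* d ℚ.- b ℚ.* c

det-·ₘ : ∀ g h → det (g ·ₘ h) ≡ det g ℚ.* det h
det-·ₘ (mat a b c d) (mat a′ b′ c′ d′) =
  solve 8 (λ a b c d a′ b′ c′ d′ →
             (a :* a′ :+ b :* c′) :* (c :* b′ :+ d :* d′) :- (a :* b′ :+ b :* d′) :* (c :* a′ :+ d :* c′)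
             := (a :* d :- b :* c) :* (a′ :* d′ :- b′ :* c′))
          refl a b c d a′ b′ c′ d′

det≢0 : ∀ {G} → IsSubgroupGL₂ℚ G → ∀ {g} → G g → det g ≢ 0ℚ
det≢0 G-subgroup {g} g∈G det≡0 with IsSubgroupGL₂ℚ.inv∈ G-subgroup g∈G
... | h , _ , gh≡I , _ = ℚP.1≢0 (begin
    1ℚ                  ≡⟨ cong det (≡.sym gh≡I) ⟩
    det (g ·ₘ h)        ≡⟨ det-·ₘ g h ⟩
    det g ℚ.* det h     ≡⟨ cong (ℚ._* det h) det≡0 ⟩
    0ℚ ℚ.* det h        ≡⟨ ℚP.*-zeroˡ (det h) ⟩
    0ℚ                  ∎)
  where open ≡-Reasoning

module Divisors {c ℓ} (R : CommutativeRing c ℓ) where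
  open CommutativeRing R renaming (Carrier to Rc; refl to ≈-refl)
  open import Algebra.Properties.AbelianGroup +-abelianGroup using (ε⁻¹≈ε; ⁻¹-∙-comm)
  open import Algebra.Properties.CommutativeSemigroup +-commutativeSemigroup using (x∙yz≈y∙xz)
  module ≈-Reasoning = Relation.Binary.Reasoning.Setoid setoid

  sub-telescope : ∀ a b d → (a - b) + (b - d) ≈ a - d
  sub-telescope a b d = begin
    (a - b) + (b - d)    ≈⟨ +-assoc a (- b) (b - d) ⟩
    a + (- b + (b - d))  ≈⟨ +-congˡ (+-assoc (- b) b (- d)) ⟨
    a + (- b + b - d)    ≈⟨ +-congˡ (+-congʳ (-‿inverseˡ b)) ⟩
    a + (0# - d)         ≈⟨ +-congˡ (+-identityˡ (- d)) ⟩
    a - d                ∎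
    where open ≈-Reasoning

  module _ {X : Set} (_≟ₓ_ : DecidableEquality X) where
    private
      coeffₓ : Div R X → X → Rc
      coeffₓ = coeff R _≟ₓ_

    coeff-++ : ∀ s t x → coeffₓ (s ++ t) x ≈ coeffₓ s x + coeffₓ t x
    coeff-++ []            t x = sym (+-identityˡ _)
    coeff-++ ((r , p) ∷ s) t x with p ≟ₓ x
    ... | yes _ = trans (+-congˡ (coeff-++ s t x)) (sym (+-assoc _ _ _))
    ... | no  _ = coeff-++ s t x

    coeff-negDiv : ∀ s x → coeffₓ (negDiv R s) x ≈ - coeffₓ s x
    coeff-negDiv []            x = sym ε⁻¹≈ε
    coeff-negDiv ((r , p) ∷ s) x with p ≟ₓ x
    ... | yes _ = trans (+-congˡ (coeff-negDiv s x)) (⁻¹-∙-comm r _)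
    ... | no  _ = coeff-negDiv s x

    coeff-sub : ∀ s t x → coeffₓ (s ++ negDiv R t) x ≈ coeffₓ s x - coeffₓ t x
    coeff-sub s t x = trans (coeff-++ s (negDiv R t) x) (+-congˡ (coeff-negDiv t x))

    coeff-∷-≡ : ∀ {r p} s {x} → p ≡ x → coeffₓ ((r , p) ∷ s) x ≈ r + coeffₓ s x
    coeff-∷-≡ {p = p} s {x} p≡x with p ≟ₓ x
    ... | yes _   = ≈-refl
    ... | no  p≢x = ⊥-elim (p≢x p≡x)

    coeff-∷-≢ : ∀ {r p} s {x} → p ≢ x → coeffₓ ((r , p) ∷ s) x ≈ coeffₓ s x
    coeff-∷-≢ {p = p} s {x} p≢x with p ≟ₓ x
    ... | yes p≡x = ⊥-elim (p≢x p≡x)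
    ... | no _    = ≈-refl

    coeff-swap : ∀ u v s x → coeffₓ (u ∷ v ∷ s) x ≈ coeffₓ (v ∷ u ∷ s) x
    coeff-swap u v s x = begin
      coeffₓ (u ∷ v ∷ s) x                                     ≈⟨ coeff-++ (u ∷ []) (v ∷ s) x ⟩
      coeffₓ (u ∷ []) x + coeffₓ (v ∷ s) x                      ≈⟨ +-congˡ (coeff-++ (v ∷ []) s x) ⟩
      coeffₓ (u ∷ []) x + (coeffₓ (v ∷ []) x + coeffₓ s x)      ≈⟨ x∙yz≈y∙xz _ _ _ ⟩
      coeffₓ (v ∷ []) x + (coeffₓ (u ∷ []) x + coeffₓ s x)      ≈⟨ +-congˡ (coeff-++ (u ∷ []) s x) ⟨
      coeffₓ (v ∷ []) x + coeffₓ (u ∷ s) x                      ≈⟨ coeff-++ (v ∷ []) (u ∷ s) x ⟨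
      coeffₓ (v ∷ u ∷ s) x                                     ∎
      where open ≈-Reasoning

    coeff-∷-cong : ∀ u {s t} x → coeffₓ s x ≈ coeffₓ t x → coeffₓ (u ∷ s) x ≈ coeffₓ (u ∷ t) x
    coeff-∷-cong (r , p) x s≈t with p ≟ₓ x
    ... | yes _ = +-congˡ s≈t
    ... | no  _ = s≈t

    Σact-++ : ∀ (α : Mat → X → X) z w → Σact R α (z ++ w) ≡ Σact R α z ++ Σact R α w
    Σact-++ α []            w = refl
    Σact-++ α ((g , m) ∷ z) w = begin
      mapDiv R (α g) m ++ negDiv R m ++ Σact R α (z ++ w)             ≡⟨ cong (λ t → mapDiv R (α g) m ++ negDiv R m ++ t) (Σact-++ α z w) ⟩
      mapDiv R (α g) m ++ negDiv R m ++ Σact R α z ++ Σact R α w      ≡⟨ cong (mapDiv R (α g) m ++_) (ListP.++-assoc (negDiv R m) _ _) ⟨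
      mapDiv R (α g) m ++ (negDiv R m ++ Σact R α z) ++ Σact R α w    ≡⟨ ListP.++-assoc (mapDiv R (α g) m) _ _ ⟨
      (mapDiv R (α g) m ++ negDiv R m ++ Σact R α z) ++ Σact R α w    ∎
      where open ≡-Reasoning

    module _ (α : Mat → X → X) (G : Mat → Set) where
      private
        _≈G[_]_ : Div R X → (Div R X → Set ℓ) → Div R X → Set (c ⊔ ℓ)
        s ≈G[ P ] t = CoinvEq R _≟ₓ_ α G P s t

      CoinvEq-mono : ∀ {P Q : Div R X → Set ℓ} → (∀ {m} → P m → Q m) →
                     ∀ {s t} → s ≈G[ P ] t → s ≈G[ Q ] t
      CoinvEq-mono P⇒Q (z , z∈ , eq) = z , All.map (map₂ P⇒Q) z∈ , eq

      CoinvEq-trans : ∀ {P s t u} → s ≈G[ P ] t → t ≈G[ P ] u → s ≈G[ P ] u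
      CoinvEq-trans {P} {s} {t} {u} (z , z∈ , s-t≈Σz) (w , w∈ , t-u≈Σw) =
        z ++ w , AllP.++⁺ z∈ w∈ , λ x → begin
          coeffₓ (s ++ negDiv R u) x                                    ≈⟨ coeff-sub s u x ⟩
          coeffₓ s x - coeffₓ u x                                       ≈⟨ sub-telescope _ (coeffₓ t x) _ ⟨
          (coeffₓ s x - coeffₓ t x) + (coeffₓ t x - coeffₓ u x)         ≈⟨ +-cong (coeff-sub s t x) (coeff-sub t u x) ⟨
          coeffₓ (s ++ negDiv R t) x + coeffₓ (t ++ negDiv R u) x       ≈⟨ +-cong (s-t≈Σz x) (t-u≈Σw x) ⟩
          coeffₓ (Σact R α z) x + coeffₓ (Σact R α w) x                 ≈⟨ coeff-++ (Σact R α z) _ x ⟨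
          coeffₓ (Σact R α z ++ Σact R α w) x                           ≡⟨ cong (λ m → coeffₓ m x) (Σact-++ α z w) ⟨
          coeffₓ (Σact R α (z ++ w)) x                                  ∎
        where open ≈-Reasoning

      Σact⇒CoinvEq-[] : ∀ {P s z} → All (λ gm → G (proj₁ gm) × P (proj₂ gm)) z →
                        DivEq R _≟ₓ_ s (Σact R α z) → s ≈G[ P ] []
      Σact⇒CoinvEq-[] {s = s} z∈ s≈Σz =
        _ , z∈ , λ x → trans (trans (coeff-++ s [] x) (+-identityʳ _)) (s≈Σz x)

      ms-basepoint-independent : ∀ {γ} → G γ → ∀ x y → ms R x (α γ x) ≈G[ InSt R ] ms R y (α γ y)
      ms-basepoint-independent γ∈G x y =
        (_ , ms R y x) ∷ [] ,
        (γ∈G , trans (+-congˡ (+-identityʳ _)) (-‿inverseʳ 1#)) ∷ [] ,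
        λ p → coeff-∷-cong _ p (coeff-swap _ _ _ p)

module Restriction {X Y : Set} (ι : X → Y) (ι⁻¹ : Y → Maybe X)
                   (ι⁻¹-ι : ∀ x → ι⁻¹ (ι x) ≡ just x)
                   (ι-ι⁻¹ : ∀ {y x} → ι⁻¹ y ≡ just x → ι x ≡ y) where

  ι-injective : ∀ {x x′} → ι x ≡ ι x′ → x ≡ x′
  ι-injective {x} {x′} ιx≡ιx′ = just-injective (≡.trans (≡.sym (ι⁻¹-ι x)) (≡.trans (cong ι⁻¹ ιx≡ιx′) (ι⁻¹-ι x′)))

  record Equivariant (f : Y → Y) (f₀ : X → X) : Set where
    field
      commutes             : ∀ x → f (ι x) ≡ ι (f₀ x)
      preserves-complement : ∀ {y} → ι⁻¹ y ≡ nothing → ι⁻¹ (f y) ≡ nothing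

  module _ {c ℓ} (R : CommutativeRing c ℓ) where
    open CommutativeRing R renaming (refl to ≈-refl)
    open Divisors R

    restrict : Div R Y → Div R X
    restrict []            = []
    restrict ((r , y) ∷ m) with ι⁻¹ y
    ... | just x  = (r , x) ∷ restrict m
    ... | nothing = restrict m

    restrict-just : ∀ {r y x} m → ι⁻¹ y ≡ just x → restrict ((r , y) ∷ m) ≡ (r , x) ∷ restrict m
    restrict-just m ι⁻¹y≡x rewrite ι⁻¹y≡x = refl

    restrict-nothing : ∀ {r y} m → ι⁻¹ y ≡ nothing → restrict ((r , y) ∷ m) ≡ restrict m
    restrict-nothing m ι⁻¹y≡∅ rewrite ι⁻¹y≡∅ = refl

    restrict-++ : ∀ s t → restrict (s ++ t) ≡ restrict s ++ restrict t
    restrict-++ []            t = refl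
    restrict-++ ((r , y) ∷ s) t with ι⁻¹ y
    ... | just x  = cong ((r , x) ∷_) (restrict-++ s t)
    ... | nothing = restrict-++ s t

    restrict-negDiv : ∀ m → restrict (negDiv R m) ≡ negDiv R (restrict m)
    restrict-negDiv []            = refl
    restrict-negDiv ((r , y) ∷ m) with ι⁻¹ y
    ... | just x  = cong ((- r , x) ∷_) (restrict-negDiv m)
    ... | nothing = restrict-negDiv m

    restrict-mapDiv : ∀ {f f₀} → Equivariant f f₀ → ∀ m → restrict (mapDiv R f m) ≡ mapDiv R f₀ (restrict m)
    restrict-mapDiv f~f₀ []            = refl
    restrict-mapDiv {f} {f₀} f~f₀ ((r , y) ∷ m) with ι⁻¹ y in ι⁻¹y
    ... | just x  = ≡.trans (restrict-just (mapDiv R f m) ι⁻¹fy≡f₀x) (cong ((r , f₀ x) ∷_) (restrict-mapDiv f~f₀ m))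
      where
      ι⁻¹fy≡f₀x : ι⁻¹ (f y) ≡ just (f₀ x)
      ι⁻¹fy≡f₀x = begin
        ι⁻¹ (f y)         ≡⟨ cong (ι⁻¹ ∘ f) (ι-ι⁻¹ ι⁻¹y) ⟨
        ι⁻¹ (f (ι x))     ≡⟨ cong ι⁻¹ (Equivariant.commutes f~f₀ x) ⟩
        ι⁻¹ (ι (f₀ x))    ≡⟨ ι⁻¹-ι (f₀ x) ⟩
        just (f₀ x)       ∎
        where open ≡-Reasoning
    ... | nothing = ≡.trans (restrict-nothing (mapDiv R f m) (Equivariant.preserves-complement f~f₀ ι⁻¹y))
                            (restrict-mapDiv f~f₀ m)

    restrict-mapDiv-ι : ∀ s → restrict (mapDiv R ι s) ≡ s
    restrict-mapDiv-ι []            = refl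
    restrict-mapDiv-ι ((r , x) ∷ s) = ≡.trans (restrict-just (mapDiv R ι s) (ι⁻¹-ι x)) (cong ((r , x) ∷_) (restrict-mapDiv-ι s))

    restrictChain : List (Mat × Div R Y) → List (Mat × Div R X)
    restrictChain = map (map₂ restrict)

    restrict-Σact : ∀ (αY : Mat → Y → Y) (αX : Mat → X → X) z →
                    All (λ gm → Equivariant (αY (proj₁ gm)) (αX (proj₁ gm))) z →
                    restrict (Σact R αY z) ≡ Σact R αX (restrictChain z)
    restrict-Σact αY αX []            []              = refl
    restrict-Σact αY αX ((g , m) ∷ z) (g-equiv ∷ z-equiv) = begin
      restrict (mapDiv R (αY g) m ++ negDiv R m ++ Σact R αY z)
        ≡⟨ restrict-++ (mapDiv R (αY g) m) _ ⟩
      restrict (mapDiv R (αY g) m) ++ restrict (negDiv R m ++ Σact R αY z)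
        ≡⟨ cong (restrict (mapDiv R (αY g) m) ++_) (restrict-++ (negDiv R m) _) ⟩
      restrict (mapDiv R (αY g) m) ++ restrict (negDiv R m) ++ restrict (Σact R αY z)
        ≡⟨ cong₂ _++_ (restrict-mapDiv g-equiv m)
                      (cong₂ _++_ (restrict-negDiv m) (restrict-Σact αY αX z z-equiv)) ⟩
      mapDiv R (αX g) (restrict m) ++ negDiv R (restrict m) ++ Σact R αX (restrictChain z) ∎
      where open ≡-Reasoning

    module _ (_≟ₓ_ : DecidableEquality X) (_≟ᵧ_ : DecidableEquality Y) where

      coeff-restrict : ∀ m x → coeff R _≟ᵧ_ m (ι x) ≈ coeff R _≟ₓ_ (restrict m) x
      coeff-restrict []            x = ≈-refl
      coeff-restrict ((r , y) ∷ m) x with ι⁻¹ y in ι⁻¹y | y ≟ᵧ ι x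
      ... | just x′ | yes y≡ιx = trans (+-congˡ (coeff-restrict m x)) (sym (coeff-∷-≡ _≟ₓ_ (restrict m) x′≡x))
        where
        x′≡x : x′ ≡ x
        x′≡x = ι-injective (≡.trans (ι-ι⁻¹ ι⁻¹y) y≡ιx)
      ... | just x′ | no y≢ιx  = trans (coeff-restrict m x) (sym (coeff-∷-≢ _≟ₓ_ (restrict m) x′≢x))
        where
        x′≢x : x′ ≢ x
        x′≢x x′≡x = y≢ιx (≡.trans (≡.sym (ι-ι⁻¹ ι⁻¹y)) (cong ι x′≡x))
      ... | nothing | yes y≡ιx with () ← ≡.trans (≡.sym ι⁻¹y) (≡.trans (cong ι⁻¹ y≡ιx) (ι⁻¹-ι x))
      ... | nothing | no _     = coeff-restrict m x

      restrict-boundary : ∀ (αY : Mat → Y → Y) (αX : Mat → X → X) {s z} →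
                          All (λ gm → Equivariant (αY (proj₁ gm)) (αX (proj₁ gm))) z →
                          DivEq R _≟ᵧ_ (mapDiv R ι s) (Σact R αY z) →
                          DivEq R _≟ₓ_ s (Σact R αX (restrictChain z))
      restrict-boundary αY αX {s} {z} z-equiv ιs≈Σz x = begin
        coeff R _≟ₓ_ s x                                ≡⟨ cong (λ m → coeff R _≟ₓ_ m x) (restrict-mapDiv-ι s) ⟨
        coeff R _≟ₓ_ (restrict (mapDiv R ι s)) x        ≈⟨ coeff-restrict (mapDiv R ι s) x ⟨
        coeff R _≟ᵧ_ (mapDiv R ι s) (ι x)               ≈⟨ ιs≈Σz (ι x) ⟩
        coeff R _≟ᵧ_ (Σact R αY z) (ι x)                ≈⟨ coeff-restrict (Σact R αY z) x ⟩
        coeff R _≟ₓ_ (restrict (Σact R αY z)) x         ≡⟨ cong (λ m → coeff R _≟ₓ_ m x) (restrict-Σact αY αX z z-equiv) ⟩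
        coeff R _≟ₓ_ (Σact R αX (restrictChain z)) x    ∎
        where open ≈-Reasoning

module QuadraticField (D : ℕ) (ns : NonSquare D) where
  open Rationals
  open QuadraticIrrationality
  private
    E = QuadF D
    module E = FieldOps E

  rational : ℚ → ℚ × ℚ
  rational q = q , 0ℚ

  rational-embedding : IsFieldEmbedding ℚF E rational
  rational-embedding = record
    { injective = cong proj₁
    ; zero-homo = refl
    ; +-homo    = λ x y → cong (x ℚ.+ y ,_) (≡.sym (ℚP.+-identityʳ 0ℚ))
    ; *-homo    = λ x y → cong₂ _,_ (solve 3 (λ x y D → x :* y := x :* y :+ D :* con 0ℚ :* con 0ℚ) refl x y (Dℚ D))
                                    (solve 2 (λ x y → con 0ℚ := x :* con 0ℚ :+ con 0ℚ :* y) refl x y)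
    ; inv-homo  = inv-rational
    ; emb-homo  = λ _ → refl
    }
    where
    inv-rational : ∀ {x} → x ≢ 0ℚ → rational (invℚ x) ≡ E.inv (rational x)
    inv-rational {x} x≢0 = cong₂ _,_
      (≡.sym (≡.trans (cong (λ N → x ℚ.* invℚ N) N≡x²) (invℚ-cancel x≢0)))
      (solve 1 (λ N⁻¹ → con 0ℚ := :- (con 0ℚ :* N⁻¹)) refl (invℚ N))
      where
      N = x ℚ.* x ℚ.- Dℚ D ℚ.* 0ℚ ℚ.* 0ℚ
      N≡x² : N ≡ x ℚ.* x
      N≡x² = solve 2 (λ x D → x :* x :- D :* con 0ℚ :* con 0ℚ := x :* x) refl x (Dℚ D)

  ι : ℙ¹ ℚF → ℙ¹ E
  ι = ιℙ¹ D

  act-ι : ∀ g p → act E g (ι p) ≡ ι (act ℚF g p)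
  act-ι g p = begin
    act E g (ι p)                 ≡⟨ cong (act E g) (ι≗map₁ p) ⟩
    act E g (map₁ rational p)     ≡⟨ act-map₁ rational-embedding g p ⟩
    map₁ rational (act ℚF g p)    ≡⟨ ι≗map₁ (act ℚF g p) ⟨
    ι (act ℚF g p)                ∎
    where
    open ≡-Reasoning
    ι≗map₁ : ∀ p → ι p ≡ map₁ rational p
    ι≗map₁ (inj₁ _)  = refl
    ι≗map₁ (inj₂ tt) = refl

  rationalPoint : ℙ¹ E → Maybe (ℙ¹ ℚF)
  rationalPoint (inj₂ tt)      = just (inj₂ tt)
  rationalPoint (inj₁ (u , v)) with v ℚP.≟ 0ℚ
  ... | yes _ = just (inj₁ u)
  ... | no  _ = nothing

  rationalPoint-ι : ∀ p → rationalPoint (ι p) ≡ just p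
  rationalPoint-ι (inj₂ tt) = refl
  rationalPoint-ι (inj₁ q) with 0ℚ ℚP.≟ 0ℚ
  ... | yes _   = refl
  ... | no 0≢0 = ⊥-elim (0≢0 refl)

  ι-rationalPoint : ∀ {y p} → rationalPoint y ≡ just p → ι p ≡ y
  ι-rationalPoint {inj₂ tt}      refl = refl
  ι-rationalPoint {inj₁ (u , v)} eq with v ℚP.≟ 0ℚ
  ι-rationalPoint {inj₁ (u , v)} refl | yes refl = refl

  rationalPoint-irrational : ∀ {u v} → v ≢ 0ℚ → rationalPoint (inj₁ (u , v)) ≡ nothing
  rationalPoint-irrational {v = v} v≢0 with v ℚP.≟ 0ℚ
  ... | yes v≡0 = ⊥-elim (v≢0 v≡0)
  ... | no  _   = refl

  rationalPoint-[∶] : ∀ {n w} → w ≢ E.zero → proj₂ (n E.* E.inv w) ≢ 0ℚ →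
                      rationalPoint (Homogeneous.[_∶_] E n w) ≡ nothing
  rationalPoint-[∶] {n} {w} w≢0 im≢0 with w E.≟ E.zero
  ... | yes w≡0 = ⊥-elim (w≢0 w≡0)
  ... | no  _   = rationalPoint-irrational im≢0

  act-irrational : ∀ {g} → det g ≢ 0ℚ → ∀ {u v} → v ≢ 0ℚ → rationalPoint (act E g (inj₁ (u , v))) ≡ nothing
  act-irrational {mat a b c d} det≢0 {u} {v} v≢0 =
    ≡.trans (cong rationalPoint (Homogeneous.act-finite E a b c d (u , v))) (rationalPoint-[∶] w≢0 im≢0)
    where
    n = E.emb a E.* (u , v) E.+ E.emb b
    w = E.emb c E.* (u , v) E.+ E.emb d
    -- the imaginary part of (az + b)/(cz + d) at z = u + v√D is v·det g / N(cz + d)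
    N⁻¹ = invℚ (proj₁ w ℚ.* proj₁ w ℚ.- Dℚ D ℚ.* proj₂ w ℚ.* proj₂ w)
    vdet≢0 : v ℚ.* (a ℚ.* d ℚ.- b ℚ.* c) ≢ 0ℚ
    vdet≢0 = *-≢0 v≢0 det≢0
    w≢0 : w ≢ E.zero
    w≢0 w≡0 = vdet≢0 (begin
      v ℚ.* (a ℚ.* d ℚ.- b ℚ.* c)
        ≡⟨ solve 7 (λ a b c d u v D → v :* (a :* d :- b :* c)
                      := a :* (c :* u :+ D :* con 0ℚ :* v :+ d) :* v :- (a :* u :+ b) :* (c :* v :+ con 0ℚ :* u :+ con 0ℚ))
                   refl a b c d u v (Dℚ D) ⟩
      a ℚ.* proj₁ w ℚ.* v ℚ.- (a ℚ.* u ℚ.+ b) ℚ.* proj₂ w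
        ≡⟨ cong₂ (λ w₁ w₂ → a ℚ.* w₁ ℚ.* v ℚ.- (a ℚ.* u ℚ.+ b) ℚ.* w₂) (cong proj₁ w≡0) (cong proj₂ w≡0) ⟩
      a ℚ.* 0ℚ ℚ.* v ℚ.- (a ℚ.* u ℚ.+ b) ℚ.* 0ℚ
        ≡⟨ solve 4 (λ a b u v → a :* con 0ℚ :* v :- (a :* u :+ b) :* con 0ℚ := con 0ℚ) refl a b u v ⟩
      0ℚ ∎)
      where open ≡-Reasoning
    im≢0 : proj₂ (n E.* E.inv w) ≢ 0ℚ
    im≢0 im≡0 = *-≢0 (invℚ-≢0 (norm≢0 ns w≢0)) vdet≢0 (≡.trans
      (solve 8 (λ a b c d u v D N⁻¹ → N⁻¹ :* (v :* (a :* d :- b :* c))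
                  := (a :* u :+ D :* con 0ℚ :* v :+ b) :* (:- ((c :* v :+ con 0ℚ :* u :+ con 0ℚ) :* N⁻¹))
                     :+ (a :* v :+ con 0ℚ :* u :+ con 0ℚ) :* ((c :* u :+ D :* con 0ℚ :* v :+ d) :* N⁻¹))
               refl a b c d u v (Dℚ D) N⁻¹)
      im≡0)

  open Restriction ι rationalPoint rationalPoint-ι ι-rationalPoint public

  act-equivariant : ∀ {g} → det g ≢ 0ℚ → Equivariant (act E g) (act ℚF g)
  act-equivariant {g} det≢0 = record
    { commutes             = act-ι g
    ; preserves-complement = λ {y} → preserves-irrational {y}
    }
    where
    preserves-irrational : ∀ {y} → rationalPoint y ≡ nothing → rationalPoint (act E g y) ≡ nothing
    preserves-irrational {inj₁ (u , v)} _ with v ℚP.≟ 0ℚ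
    ... | no v≢0 = act-irrational {g} det≢0 {u} v≢0
    preserves-irrational {inj₁ (u , v)} () | yes _
    preserves-irrational {inj₂ tt} ()

theorem5p3 : ∀ {c ℓ} (R : CommutativeRing c ℓ) (D : ℕ) → 1 < D → NonSquare D →
    (G : Mat → Set) → IsSubgroupGL₂ℚ G →
    ((s : Div R (ℙ¹ ℚF)) → InSt R s → InImψ R D G s → InH₀cusp R G s)
    × ((x y : ℙ¹ ℚF) (γ : Mat) → G γ →
       _≈St[_]_ R (ms R x (act ℚF γ x)) G (ms R y (act ℚF γ y)))
theorem5p3 R D _ ns G G-subgroup =
  cuspidal , λ x y γ γ∈G → ms-basepoint-independent ℙ¹ℚ-≟ (act ℚF) G γ∈G x y
  where
  open Divisors R
  open QuadraticField D ns
  ℙ¹ℚ-≟ = ℙ¹-≟ ℚF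

  cuspidal : (s : Div R (ℙ¹ ℚF)) → InSt R s → InImψ R D G s → InH₀cusp R G s
  cuspidal s s∈St (z , z∈ , s′ , ιs′≈Σz , s≈s′) =
    s∈St ,
    CoinvEq-trans ℙ¹ℚ-≟ (act ℚF) G {s = s} {t = s′}
      (CoinvEq-mono ℙ¹ℚ-≟ (act ℚF) G (λ _ → lift tt) {s = s} {t = s′} s≈s′)
      (Σact⇒CoinvEq-[] ℙ¹ℚ-≟ (act ℚF) G {s = s′}
        (AllP.map⁺ (All.map (λ gm∈ → proj₁ gm∈ , lift tt) z∈))
        (restrict-boundary R ℙ¹ℚ-≟ (ℙ¹-≟ (QuadF D)) (act (QuadF D)) (act ℚF) {s = s′}
          (All.map (λ gm∈ → act-equivariant (det≢0 G-subgroup (proj₁ gm∈))) z∈) ιs′≈Σz))
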